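{- Let $\hat G$ be a graph and $\hat A,\hat B\subseteq V(\hat G)$ two sets of cardinality $\hat N>0$ each, such that $\hat G$ has the perfect unique linkage property with respect to $(\hat A,\hat B)$, with unique linkage $\hat{\mathcal R}$. Let $\hat{\mathcal Q}$ be a set of node-disjoint paths in $\hat G$ such that every path of $\hat{\mathcal Q}$ intersects at least one path of $\hat{\mathcal R}$, and let $\hat M,\hat w>0$ be integers with $|\hat{\mathcal Q}|\geq \hat M\hat w+(\hat M+1)\hat N$. Then there is an $\hat M$-slicing of $\hat{\mathcal R}$ of width at least $\hat w$ with respect to $\hat{\mathcal Q}$.
   Context: For $Y,Z\subseteq V(\hat G)$ with $|Y|=|Z|=r$, $\hat G$ has the unique linkage property with respect to $(Y,Z)$ if there is exactly one set of $r$ node-disjoint paths in $\hat G$ connecting every vertex of $Y$ to a distinct vertex of $Z$ (a $(Y,Z)$-linkage); it has the perfect unique linkage property if additionally every vertex of $\hat G$ lies on a path of this unique linkage. Each path $R\in\hat{\mathcal R}$ is oriented from its endpoint $a(R)\in\hat A$ (first endpoint) to its endpoint $b(R)\in\hat B$ (last endpoint). An $\hat M$-slicing $\Lambda$ of $\hat{\mathcal R}$ assigns to each $R\in\hat{\mathcal R}$ a sequence $(v_0(R),\ldots,v_{\hat M}(R))$ of vertices of $R$ appearing on $R$ in this order (repetitions allowed) with $v_0(R)=a(R)$, $v_{\hat M}(R)=b(R)$. For $1\le i\le\hat M$, $\sigma_i(R)$ is the sub-path of $R$ strictly between $v_{i-1}(R)$ and $v_i(R)$ (excluding both; possibly empty),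 $\Sigma_i=\{\sigma_i(R)\mid R\in\hat{\mathcal R}\}$, and $\hat{\mathcal Q}_i$ is the set of paths $Q\in\hat{\mathcal Q}$ such that every vertex of $Q$ lying on a path of $\hat{\mathcal R}$ belongs to $\bigcup_{\sigma\in\Sigma_i}\sigma$. The width of $\Lambda$ with respect to $\hat{\mathcal Q}$ is $\min_{1\le i\le \hat M}|\hat{\mathcal Q}_i|$. Two paths intersect if they share a vertex. -}

module Defs where

open import Level using (0ℓ)
open import Data.Nat as ℕ using (ℕ; zero; suc; _∸_)
open import Data.Fin as Fin using (Fin; toℕ; inject₁; fromℕ)
open import Data.List using (List; []; _∷_; _∷ʳ_; length; lookup)
open import Data.List.Membership.Propositional using (_∈_)
open import Data.List.Relation.Unary.All using (All)
open import Data.List.Relation.Unary.Any using (Any)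
open import Data.List.Relation.Unary.AllPairs using (AllPairs)
open import Data.List.Relation.Unary.Linked using (Linked)
open import Data.List.Relation.Unary.Unique.Propositional using (Unique)
open import Data.List.Relation.Binary.Permutation.Propositional using (_↭_)
open import Data.List.Relation.Binary.Sublist.Propositional using (_⊆_)
open import Data.Product using (Σ; ∃; ∃-syntax; _×_)
open import Data.Empty using (⊥)
open import Relation.Nullary using (¬_)
open import Relation.Binary.PropositionalEquality using (_≡_)

record Graph (n : ℕ) : Set₁ where
  field
    Adj    : Fin n → Fin n → Set
    sym    : ∀ {u v} → Adj u v → Adj v u
    irrefl : ∀ {v} → ¬ Adj v v
open Graph public

Vertex-list : ℕ → Set
Vertex-list n = List (Fin n)

IsPath : ∀ {n} → Graph n → List (Fin n) → Set
IsPath G p = (¬ (p ≡ [])) × Unique p × Linked (Adj G) p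

Intersect : ∀ {n} → List (Fin n) → List (Fin n) → Set
Intersect p q = ∃[ v ] (v ∈ p × v ∈ q)

Disjoint : ∀ {n} → List (Fin n) → List (Fin n) → Set
Disjoint p q = ¬ Intersect p q

-- A set of node-disjoint paths in G (a list of pairwise disjoint paths;
-- pairwise disjoint non-empty paths are automatically distinct).
DisjointPaths : ∀ {n} → Graph n → List (List (Fin n)) → Set
DisjointPaths G ps = All (IsPath G) ps × AllPairs Disjoint ps

StartsIn : ∀ {n} → List (Fin n) → List (Fin n) → Set
StartsIn Y p = ∃[ v ] ∃[ rest ] (p ≡ v ∷ rest × v ∈ Y)

EndsIn : ∀ {n} → List (Fin n) → List (Fin n) → Set
EndsIn Z p = ∃[ v ] ∃[ rest ] (p ≡ rest ∷ʳ v × v ∈ Z)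

-- (Y,Z)-linkage: |Y| node-disjoint paths, each oriented from a vertex of Y
-- to a vertex of Z (disjointness forces distinct endpoints).
Linkage : ∀ {n} → Graph n → List (Fin n) → List (Fin n) → List (List (Fin n)) → Set
Linkage G Y Z L =
  DisjointPaths G L × length L ≡ length Y × All (λ p → StartsIn Y p × EndsIn Z p) L

UniqueLinkage : ∀ {n} → Graph n → List (Fin n) → List (Fin n) → List (List (Fin n)) → Set
UniqueLinkage G Y Z L = Linkage G Y Z L × (∀ L′ → Linkage G Y Z L′ → L′ ↭ L)

PerfectUniqueLinkage : ∀ {n} → Graph n → List (Fin n) → List (Fin n) → List (List (Fin n)) → Set
PerfectUniqueLinkage G Y Z L = UniqueLinkage G Y Z L × (∀ v → Any (v ∈_) L)

record SliceSeq (M : ℕ) {n : ℕ} (R : List (Fin n)) : Set where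
  field
    pos   : Fin (suc M) → Fin (length R)
    mono  : ∀ i j → i Fin.≤ j → pos i Fin.≤ pos j
    first : toℕ (pos Fin.zero) ≡ 0
    last  : toℕ (pos (fromℕ M)) ≡ length R ∸ 1
open SliceSeq public

Slicing : ℕ → ∀ {n} → List (List (Fin n)) → Set
Slicing M L = (j : Fin (length L)) → SliceSeq M (lookup L j)

-- v lies on σ_{i+1}(R) for some R ∈ L (i : Fin M encodes the index i+1 ∈ {1..M}):
-- strictly between v_i(R) and v_{i+1}(R).
InSigma : ∀ {M n} (L : List (List (Fin n))) → Slicing M L → Fin M → Fin n → Set
InSigma L S i v =
  ∃[ j ] ∃[ k ] (lookup (lookup L j) k ≡ v
               × pos (S j) (inject₁ i) Fin.< k
               × k Fin.< pos (S j) (Fin.suc i))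

OnSomePath : ∀ {n} → List (List (Fin n)) → Fin n → Set
OnSomePath L v = Any (v ∈_) L

InQi : ∀ {M n} (L : List (List (Fin n))) → Slicing M L → Fin M → List (Fin n) → Set
InQi L S i q = ∀ v → v ∈ q → OnSomePath L v → InSigma L S i v

WidthAtLeast : ∀ {M n} (L : List (List (Fin n))) → Slicing M L →
               List (List (Fin n)) → ℕ → Set
WidthAtLeast L S Q w =
  ∀ i → ∃[ Q′ ] (Q′ ⊆ Q × w ℕ.≤ length Q′ × All (InQi L S i) Q′)

module Submission where

-- Every vertex lies on exactly one path of the perfect linkage R, at some position. A cut picks a
-- position on each path of R; it is separated if every edge of a Q-path from a vertex at or behind
-- the cut to a vertex ahead of it starts on the cut. Starting from the first vertices, we advance
-- one path at a time by one vertex while keeping the cut separated. This is always possible: if on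
-- every unfinished path j some Q-edge led from the cut vertex of j to a vertex ahead of the cut other
-- than its successor on j, following these edges would produce a cycle of paths along which R could
-- be rerouted into a second (A,B)-linkage. Each step increases by at most one the number of Q-paths
-- lying strictly behind the cut, so we can stop at cuts with exactly m(N + w) of them for m < M,
-- and take the last vertices of R for m = M. A Q-path behind the (m+1)-st cut but not behind the
-- m-th either meets the m-th cut, which happens for at most N of them as Q is disjoint, or by
-- separation lies strictly between the two cuts; hence at least w of them lie in the m-th slice.

open import Defs
open import Data.Nat using (ℕ; _+_; _*_; _≤_; _<_; suc)
open import Data.Fin using (Fin)
open import Data.List using (List; length)
open import Data.List.Relation.Unary.All using (All)
open import Data.List.Relation.Unary.Any using (Any)
open import Data.List.Relation.Unary.Unique.Propositional using (Unique)
open import Data.Product using (Σ)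
open import Relation.Binary.PropositionalEquality using (_≡_)

open import Level using (0ℓ)
open import Data.Nat using (zero; _∸_; z≤n; s≤s; _≟_; _<?_; _≤?_)
open import Data.Nat.Properties
open import Data.Fin as Fin using (toℕ; fromℕ<)
import Data.Fin.Properties as Finₚ
open import Data.List using ([]; _∷_; _++_; [_]; lookup; take; drop; filter; tabulate; concatMap)
import Data.List.Properties as Listₚ
open import Data.List.Membership.Propositional using (_∈_; find; lose)
import Data.List.Membership.Propositional.Properties as ∈ₚ
open import Data.List.Relation.Unary.Any as Any using (here; there)
import Data.List.Relation.Unary.Any.Properties as Anyₚ
open import Data.List.Relation.Unary.All as All using ([]; _∷_)
import Data.List.Relation.Unary.All.Properties as Allₚ
open import Data.List.Relation.Unary.AllPairs using (AllPairs; []; _∷_)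
import Data.List.Relation.Unary.AllPairs.Properties as AllPairsₚ
open import Data.List.Relation.Unary.Linked using (Linked; []; [-]; _∷_)
import Data.List.Relation.Unary.Unique.Propositional.Properties as Uniqueₚ
open import Data.List.Relation.Binary.Permutation.Propositional.Properties using (∈-resp-↭)
open import Data.List.Relation.Binary.Sublist.Propositional.Properties using (filter-⊆)
open import Data.Product using (∃-syntax; _×_; _,_; proj₁; proj₂; map₂)
open import Data.Sum as Sum using (_⊎_; inj₁; inj₂; [_,_]′)
open import Data.Empty using (⊥; ⊥-elim)
open import Data.Unit using (⊤)
open import Function using (_∘_; id)
open import Data.Nat.Tactic.RingSolver using (solve-∀)
open import Relation.Nullary using (¬_; Dec; yes; no; ¬?; _×-dec_; _⊎-dec_)
open import Relation.Nullary.Decidable using (decidable-stable)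
open import Relation.Unary using (Pred; Decidable)
open import Relation.Binary.Definitions using (tri<; tri≈; tri>)
open import Relation.Binary.PropositionalEquality as ≡ using (_≢_; refl; trans; cong; subst; subst₂)

private variable
  A : Set
  _∼_ : A → A → Set
  x y : A
  xs ys : List A

lookup-injective : Unique xs → (i k : Fin (length xs)) → lookup xs i ≡ lookup xs k → i ≡ k
lookup-injective (_ ∷ _) Fin.zero Fin.zero _ = refl
lookup-injective (x∉ ∷ _) Fin.zero (Fin.suc k) eq = ⊥-elim (All.lookup x∉ (∈ₚ.∈-lookup k) eq)
lookup-injective (x∉ ∷ _) (Fin.suc i) Fin.zero eq = ⊥-elim (All.lookup x∉ (∈ₚ.∈-lookup i) (≡.sym eq))
lookup-injective (_ ∷ u) (Fin.suc i) (Fin.suc k) eq = cong Fin.suc (lookup-injective u i k eq)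

AllPairs-lookup : AllPairs _∼_ xs → (i k : Fin (length xs)) → toℕ i < toℕ k → lookup xs i ∼ lookup xs k
AllPairs-lookup (x∼ ∷ _) Fin.zero (Fin.suc k) _ = All.lookup x∼ (∈ₚ.∈-lookup k)
AllPairs-lookup (_ ∷ ∼xs) (Fin.suc i) (Fin.suc k) (s≤s i<k) = AllPairs-lookup ∼xs i k i<k

∈-take⁻ : ∀ m xs → x ∈ take m xs → ∃[ k ] (toℕ k < m × lookup xs k ≡ x)
∈-take⁻ (suc m) (x ∷ xs) (here refl) = Fin.zero , s≤s z≤n , refl
∈-take⁻ (suc m) (x ∷ xs) (there x∈) with k , k<m , eq ← ∈-take⁻ m xs x∈ = Fin.suc k , s≤s k<m , eq

∈-drop⁻ : ∀ m xs → x ∈ drop m xs → ∃[ k ] (m ≤ toℕ k × lookup xs k ≡ x)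
∈-drop⁻ zero xs x∈ = Any.index x∈ , z≤n , ≡.sym (Anyₚ.lookup-index x∈)
∈-drop⁻ (suc m) (x ∷ xs) x∈ with k , m≤k , eq ← ∈-drop⁻ m xs x∈ = Fin.suc k , s≤s m≤k , eq

drop-lookup : ∀ (xs : List A) k → drop (toℕ k) xs ≡ lookup xs k ∷ drop (suc (toℕ k)) xs
drop-lookup (x ∷ xs) Fin.zero = refl
drop-lookup (x ∷ xs) (Fin.suc k) = drop-lookup xs k

drop≡∷⇒lookup : ∀ m (xs : List A) → drop m xs ≡ y ∷ ys → ∃[ k ] (toℕ k ≡ m × lookup xs k ≡ y)
drop≡∷⇒lookup zero (x ∷ xs) refl = Fin.zero , refl , refl
drop≡∷⇒lookup (suc m) (x ∷ xs) eq with k , k≡m , eq′ ← drop≡∷⇒lookup m xs eq = Fin.suc k , cong suc k≡m , eq′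

Linked-drop⁺ : ∀ m → Linked _∼_ xs → Linked _∼_ (drop m xs)
Linked-drop⁺ zero l = l
Linked-drop⁺ (suc m) [] = []
Linked-drop⁺ (suc m) [-] = Linked-drop⁺ m []
Linked-drop⁺ (suc m) (_ ∷ l) = Linked-drop⁺ m l

Linked-take-++ : ∀ m (m< : m < length xs) → Linked _∼_ xs → lookup xs (fromℕ< m<) ∼ y →
                 Linked _∼_ (y ∷ ys) → Linked _∼_ (take (suc m) xs ++ y ∷ ys)
Linked-take-++ {xs = _ ∷ []} zero _ _ r l = r ∷ l
Linked-take-++ {xs = _ ∷ []} (suc m) (s≤s ()) _ _ _
Linked-take-++ {xs = _ ∷ _ ∷ _} zero _ _ r l = r ∷ l
Linked-take-++ {xs = _ ∷ _ ∷ _} (suc m) (s≤s m<) (r′ ∷ lxs) r l = r′ ∷ Linked-take-++ m m< lxs r l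

head∈take-suc : ∀ m (xs : List A) → 0 < length xs → ∃[ x ] (x ∈ take (suc m) xs)
head∈take-suc m (x ∷ _) _ = x , here refl

drop-++ : ∀ m (xs ys : List A) → m ≤ length xs → drop m (xs ++ ys) ≡ drop m xs ++ ys
drop-++ zero xs ys _ = refl
drop-++ (suc m) (x ∷ xs) ys (s≤s m≤) = drop-++ m xs ys m≤

module _ {n} {G : Graph n} where

  take-++-drop-isPath : ∀ {xs ys} m (m< : m < length xs) (p : Fin (length ys)) →
    IsPath G xs → IsPath G ys → Adj G (lookup xs (fromℕ< m<)) (lookup ys p) →
    Disjoint (take (suc m) xs) (drop (toℕ p) ys) → IsPath G (take (suc m) xs ++ drop (toℕ p) ys)
  take-++-drop-isPath {x ∷ _} {ys} m m< p (_ , uxs , lxs) (_ , uys , lys) adj disj =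
    (λ ()) ,
    Uniqueₚ.++⁺ (Uniqueₚ.take⁺ (suc m) uxs) (Uniqueₚ.drop⁺ (toℕ p) uys) (λ (v∈ , v∈′) → disj (_ , v∈ , v∈′)) ,
    subst (λ zs → Linked (Adj G) (take (suc m) (x ∷ _) ++ zs)) (≡.sym (drop-lookup ys p))
      (Linked-take-++ m m< lxs adj (subst (Linked (Adj G)) (drop-lookup ys p) (Linked-drop⁺ (toℕ p) lys)))

StartsIn-take-++ : ∀ {n} {Y xs : List (Fin n)} m zs → StartsIn Y xs → StartsIn Y (take (suc m) xs ++ zs)
StartsIn-take-++ m zs (v , rest , refl , v∈) = v , _ , refl , v∈

EndsIn-++-drop : ∀ {n} {Z ys : List (Fin n)} xs (p : Fin (length ys)) → EndsIn Z ys → EndsIn Z (xs ++ drop (toℕ p) ys)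
EndsIn-++-drop xs p (v , rest , refl , v∈) =
  v , xs ++ drop (toℕ p) rest ,
  trans (cong (xs ++_) (drop-++ (toℕ p) rest [ v ] p≤)) (≡.sym (Listₚ.++-assoc xs (drop (toℕ p) rest) [ v ])) ,
  v∈
  where
  p≤ : toℕ p ≤ length rest
  p≤ = ≤-pred (subst (toℕ p <_) (trans (Listₚ.length-++ rest) (+-comm (length rest) 1)) (Finₚ.toℕ<n p))

count : {P : Pred A 0ℓ} → Decidable P → List A → ℕ
count P? xs = length (filter P? xs)

module _ {P P₁ P₂ : Pred A 0ℓ} (P? : Decidable P) (P₁? : Decidable P₁) (P₂? : Decidable P₂) where

  count-≤-+ : ∀ xs → All (λ x → P x → P₁ x ⊎ P₂ x) xs → count P? xs ≤ count P₁? xs + count P₂? xs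
  count-≤-+ [] [] = z≤n
  count-≤-+ (x ∷ xs) (h ∷ hs) with ih ← count-≤-+ xs hs | P? x | P₁? x | P₂? x
  ... | no _  | no _   | no _   = ih
  ... | no _  | yes _  | no _   = m≤n⇒m≤1+n ih
  ... | no _  | no _   | yes _  = ≤-trans ih (+-monoʳ-≤ _ (n≤1+n _))
  ... | no _  | yes _  | yes _  = ≤-trans ih (≤-trans (n≤1+n _) (s≤s (+-monoʳ-≤ _ (n≤1+n _))))
  ... | yes p | no ¬p₁ | no ¬p₂ = ⊥-elim ([ ¬p₁ , ¬p₂ ]′ (h p))
  ... | yes _ | yes _  | no _   = s≤s ih
  ... | yes _ | yes _  | yes _  = s≤s (≤-trans ih (+-monoʳ-≤ _ (n≤1+n _)))
  ... | yes _ | no _   | yes _  = ≤-trans (s≤s ih) (≤-reflexive (≡.sym (+-suc _ _)))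

length-≤-count-+ : {P₁ P₂ : Pred A 0ℓ} (P₁? : Decidable P₁) (P₂? : Decidable P₂) →
  ∀ xs → All (λ x → P₁ x ⊎ P₂ x) xs → length xs ≤ count P₁? xs + count P₂? xs
length-≤-count-+ P₁? P₂? xs cover =
  subst (_≤ count P₁? xs + count P₂? xs) (cong length (Listₚ.filter-all yes? {xs} (All.tabulate λ _ → _)))
    (count-≤-+ yes? P₁? P₂? xs (All.map (λ h _ → h) cover))
  where
  yes? : Decidable {A = A} (λ _ → ⊤)
  yes? _ = yes _

module _ {n : ℕ} where

  Meets : List (Fin n) → Pred (List (Fin n)) 0ℓ
  Meets vs q = Any (_∈ vs) q

  meets? : ∀ vs → Decidable (Meets vs)
  meets? vs = Any.any? (λ v → Any.any? (v Fin.≟_) vs)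

  count-∋-≤1 : ∀ v {qs : List (List (Fin n))} → AllPairs Disjoint qs → count (Any.any? (v Fin.≟_)) qs ≤ 1
  count-∋-≤1 v [] = z≤n
  count-∋-≤1 v {q ∷ qs} (disj ∷ disjs) with Any.any? (v Fin.≟_) q
  ... | no _ = count-∋-≤1 v disjs
  ... | yes v∈q = s≤s (≤-reflexive (cong length (Listₚ.filter-none (Any.any? (v Fin.≟_))
                    (All.map (λ d v∈q′ → d (v , v∈q , v∈q′)) disj))))

  count-meets-≤ : ∀ vs {qs : List (List (Fin n))} → AllPairs Disjoint qs → count (meets? vs) qs ≤ length vs
  count-meets-≤ [] {qs} _ = ≤-reflexive (cong length (Listₚ.filter-none (meets? []) {qs}
                              (All.tabulate λ _ m → Anyₚ.¬Any[] (proj₂ (proj₂ (find m))))))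
  count-meets-≤ (v ∷ vs) {qs} disj =
    ≤-trans (count-≤-+ (meets? (v ∷ vs)) (Any.any? (v Fin.≟_)) (meets? vs) qs (All.tabulate λ _ → split))
            (+-mono-≤ (count-∋-≤1 v disj) (count-meets-≤ vs disj))
    where
    split : ∀ {q} → Meets (v ∷ vs) q → v ∈ q ⊎ Meets vs q
    split m with find m
    ... | u , u∈q , here refl = inj₁ u∈q
    ... | u , u∈q , there u∈vs = inj₂ (lose u∈q u∈vs)

∑ : ∀ {m} → (Fin m → ℕ) → ℕ
∑ {zero} f = 0
∑ {suc m} f = f Fin.zero + ∑ (f ∘ Fin.suc)

∑-mono-≤ : ∀ {m} {f g : Fin m → ℕ} → (∀ i → f i ≤ g i) → ∑ f ≤ ∑ g
∑-mono-≤ {zero} _ = z≤n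
∑-mono-≤ {suc m} f≤g = +-mono-≤ (f≤g Fin.zero) (∑-mono-≤ (f≤g ∘ Fin.suc))

∑-mono-< : ∀ {m} {f g : Fin m → ℕ} → (∀ i → f i ≤ g i) → ∀ j → f j < g j → ∑ f < ∑ g
∑-mono-< {suc m} f≤g Fin.zero f<g = +-mono-<-≤ f<g (∑-mono-≤ (f≤g ∘ Fin.suc))
∑-mono-< {suc m} f≤g (Fin.suc j) f<g = +-mono-≤-< (f≤g Fin.zero) (∑-mono-< (f≤g ∘ Fin.suc) j f<g)

-- Cycles of an endofunction of a finite set

record CycleIn {K : ℕ} (F : Fin K → Fin K) (P : Pred (Fin K) 0ℓ) : Set₁ where
  field
    OnCycle     : Pred (Fin K) 0ℓ
    onCycle?    : Decidable OnCycle
    root        : Fin K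
    root-on     : OnCycle root
    on⇒P        : ∀ {j} → OnCycle j → P j
    F-on        : ∀ {j} → OnCycle j → OnCycle (F j)
    F-injective : ∀ {j j′} → OnCycle j → OnCycle j′ → F j ≡ F j′ → j ≡ j′

module Iteration {K : ℕ} (F : Fin K → Fin K) where

  iterate : ℕ → Fin K → Fin K
  iterate zero j = j
  iterate (suc m) j = F (iterate m j)

  iterate-+ : ∀ a b j → iterate (a + b) j ≡ iterate a (iterate b j)
  iterate-+ zero b j = refl
  iterate-+ (suc a) b j = cong F (iterate-+ a b j)

  Distinct : Fin K → ℕ → Set
  Distinct j L = ∀ {m m′} → m < L → m′ < L → iterate m j ≡ iterate m′ j → m ≡ m′

  record Periodic (j : Fin K) : Set where
    field
      period   : ℕ
      period>0 : 0 < period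
      returns  : iterate period j ≡ j
      distinct : Distinct j period

  private
    distinct-suc : ∀ {j b} → Distinct j b → ¬ (∃[ a ] (a < b × iterate a j ≡ iterate b j)) → Distinct j (suc b)
    distinct-suc {b = b} D new {m} {m′} m< m′< eq with m<1+n⇒m<n∨m≡n m< | m<1+n⇒m<n∨m≡n m′<
    ... | inj₁ m<b  | inj₁ m′<b = D m<b m′<b eq
    ... | inj₁ m<b  | inj₂ refl = ⊥-elim (new (m , m<b , eq))
    ... | inj₂ refl | inj₁ m′<b = ⊥-elim (new (m′ , m′<b , ≡.sym eq))
    ... | inj₂ refl | inj₂ refl = refl

    -- the first b iterates are distinct and r + b = K + 1, so by pigeonhole a repetition occurs within r more steps
    search : ∀ j₀ r b → r + b ≡ suc K → Distinct j₀ b → ∃[ a ] Periodic (iterate a j₀)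
    search j₀ zero b b≡ D
      with i , i′ , i<i′ , eq ← Finₚ.pigeonhole (≤-reflexive (≡.sym b≡)) (λ i → iterate (toℕ i) j₀)
      = ⊥-elim (<⇒≢ i<i′ (D (Finₚ.toℕ<n i) (Finₚ.toℕ<n i′) eq))
    search j₀ (suc r) b b≡ D with anyUpTo? (λ a → iterate a j₀ Fin.≟ iterate b j₀) b
    ... | no new = search j₀ r (suc b) (trans (+-suc r b) b≡) (distinct-suc D new)
    ... | yes (a , a<b , eq) = a , record
      { period = b ∸ a ; period>0 = m<n⇒0<n∸m a<b ; returns = returns ; distinct = distinct }
      where
      b∸a+a : b ∸ a + a ≡ b
      b∸a+a = m∸n+n≡m (<⇒≤ a<b)
      returns : iterate (b ∸ a) (iterate a j₀) ≡ iterate a j₀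
      returns = trans (≡.sym (iterate-+ (b ∸ a) a j₀)) (trans (cong (λ m → iterate m j₀) b∸a+a) (≡.sym eq))
      distinct : Distinct (iterate a j₀) (b ∸ a)
      distinct {m} {m′} m< m′< eq′ = +-cancelʳ-≡ a m m′ (D
        (subst (m + a <_) b∸a+a (+-monoˡ-< a m<)) (subst (m′ + a <_) b∸a+a (+-monoˡ-< a m′<))
        (trans (iterate-+ m a j₀) (trans eq′ (≡.sym (iterate-+ m′ a j₀)))))

  eventually-periodic : ∀ j₀ → ∃[ a ] Periodic (iterate a j₀)
  eventually-periodic j₀ = search j₀ (suc K) 0 (+-identityʳ (suc K)) (λ ())

  module Orbit {j* : Fin K} (per : Periodic j*) where
    open Periodic per

    InOrbit : Pred (Fin K) 0ℓ
    InOrbit j = ∃[ m ] (m < period × iterate m j* ≡ j)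

    -- normal form of the index of F j for j = F^m j*: either m+1, or 0 when m+1 is the period
    successor : ∀ {m} → m < period →
      ∃[ m′ ] (m′ < period × iterate m′ j* ≡ iterate (suc m) j* × ((m′ ≡ 0 × suc m ≡ period) ⊎ m′ ≡ suc m))
    successor {m} m< with m<1+n⇒m<n∨m≡n (s≤s m<)
    ... | inj₁ sm< = suc m , sm< , refl , inj₂ refl
    ... | inj₂ sm≡ = 0 , period>0 , trans (≡.sym returns) (cong (λ k → iterate k j*) (≡.sym sm≡)) , inj₁ (refl , sm≡)

    F-injective : ∀ {j j′} → InOrbit j → InOrbit j′ → F j ≡ F j′ → j ≡ j′
    F-injective (m , m< , refl) (m′ , m′< , refl) eq
      with k , k< , k≡ , kform ← successor m<
         | k′ , k′< , k′≡ , k′form ← successor m′<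
      = cong (λ i → iterate i j*) (same-predecessor kform k′form (distinct k< k′< (trans k≡ (trans eq (≡.sym k′≡)))))
      where
      same-predecessor : ∀ {k k′} → ((k ≡ 0 × suc m ≡ period) ⊎ k ≡ suc m) →
        ((k′ ≡ 0 × suc m′ ≡ period) ⊎ k′ ≡ suc m′) → k ≡ k′ → m ≡ m′
      same-predecessor (inj₁ (_ , p)) (inj₁ (_ , p′)) _ = suc-injective (trans p (≡.sym p′))
      same-predecessor (inj₂ refl) (inj₂ refl) refl = refl
      same-predecessor (inj₁ (refl , _)) (inj₂ refl) ()
      same-predecessor (inj₂ refl) (inj₁ (refl , _)) ()

    orbit : (P : Pred (Fin K) 0ℓ) → (∀ {m} → P (iterate m j*)) → CycleIn F P
    orbit P P-iterate = record
      { OnCycle     = InOrbit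
      ; onCycle?    = λ j → anyUpTo? (λ m → iterate m j* Fin.≟ j) period
      ; root        = j*
      ; root-on     = 0 , period>0 , refl
      ; on⇒P        = λ { (m , _ , refl) → P-iterate {m} }
      ; F-on        = λ { (m , m< , refl) → let (k , k< , k≡ , _) = successor m< in k , k< , k≡ }
      ; F-injective = F-injective
      }

  invariant⇒cycleIn : (P : Pred (Fin K) 0ℓ) → (∀ {j} → P j → P (F j)) → ∀ {j₀} → P j₀ → CycleIn F P
  invariant⇒cycleIn P P-F {j₀} Pj₀ with a , per ← eventually-periodic j₀ =
    Orbit.orbit per P (λ {m} → subst P (iterate-+ m a j₀) (P-iterate (m + a)))
    where
    P-iterate : ∀ m → P (iterate m j₀)
    P-iterate zero = Pj₀
    P-iterate (suc m) = P-F (P-iterate m)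

-- Coordinates along a perfect linkage, and cuts

module Coordinates {n} {G : Graph n} {R : List (List (Fin n))}
                   (R-paths : DisjointPaths G R) (R-covers : ∀ v → Any (v ∈_) R) where

  K : ℕ
  K = length R

  path : Fin K → List (Fin n)
  path j = lookup R j

  len : Fin K → ℕ
  len j = length (path j)

  path-isPath : ∀ j → IsPath G (path j)
  path-isPath j = All.lookup (proj₁ R-paths) (∈ₚ.∈-lookup j)

  len>0 : ∀ j → 0 < len j
  len>0 j with path j | proj₁ (path-isPath j)
  ... | []    | nonempty = ⊥-elim (nonempty refl)
  ... | _ ∷ _ | _        = s≤s z≤n

  path-disjoint : ∀ {j j′} → j ≢ j′ → Disjoint (path j) (path j′)
  path-disjoint {j} {j′} j≢j′ with <-cmp (toℕ j) (toℕ j′)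
  ... | tri< j<j′ _ _ = AllPairs-lookup (proj₂ R-paths) j j′ j<j′
  ... | tri≈ _ j≡j′ _ = ⊥-elim (j≢j′ (Finₚ.toℕ-injective j≡j′))
  ... | tri> _ _ j′<j = λ (v , v∈ , v∈′) → AllPairs-lookup (proj₂ R-paths) j′ j j′<j (v , v∈′ , v∈)

  pathOf : Fin n → Fin K
  pathOf v = Any.index (R-covers v)

  ∈-pathOf : ∀ v → v ∈ path (pathOf v)
  ∈-pathOf v = Anyₚ.lookup-index (R-covers v)

  indexOf : ∀ v → Fin (len (pathOf v))
  indexOf v = Any.index (∈-pathOf v)

  posOf : Fin n → ℕ
  posOf v = toℕ (indexOf v)

  lookup-indexOf : ∀ v → lookup (path (pathOf v)) (indexOf v) ≡ v
  lookup-indexOf v = ≡.sym (Anyₚ.lookup-index (∈-pathOf v))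

  posOf<len : ∀ v → posOf v < len (pathOf v)
  posOf<len v = Finₚ.toℕ<n (indexOf v)

  lookup⇒coordinates : ∀ j k {v} → lookup (path j) k ≡ v → pathOf v ≡ j × posOf v ≡ toℕ k
  lookup⇒coordinates j k {v} eq with pathOf v Fin.≟ j
  ... | no ≢j = ⊥-elim (path-disjoint ≢j (v , ∈-pathOf v , subst (_∈ path j) eq (∈ₚ.∈-lookup k)))
  ... | yes refl = refl , cong toℕ (lookup-injective (proj₁ (proj₂ (path-isPath j))) (indexOf v) k
                                     (trans (lookup-indexOf v) (≡.sym eq)))

  coordinates-injective : ∀ {v v′} → pathOf v ≡ pathOf v′ → posOf v ≡ posOf v′ → v ≡ v′
  coordinates-injective {v} {v′} = at (indexOf v) (lookup-indexOf v)
    where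
    at : ∀ {j} (k : Fin (len j)) → lookup (path j) k ≡ v → j ≡ pathOf v′ → toℕ k ≡ posOf v′ → v ≡ v′
    at k eq refl k≡ = trans (≡.sym eq) (trans (cong (lookup (path (pathOf v′))) (Finₚ.toℕ-injective k≡)) (lookup-indexOf v′))

  ∈-path⇒pathOf : ∀ {j v} → v ∈ path j → pathOf v ≡ j
  ∈-path⇒pathOf {j} v∈ = proj₁ (lookup⇒coordinates j (Any.index v∈) (≡.sym (Anyₚ.lookup-index v∈)))

  ∈-take-path : ∀ {j v} m → v ∈ take m (path j) → pathOf v ≡ j × posOf v < m
  ∈-take-path {j} m v∈ =
    let k , k< , eq = ∈-take⁻ m (path j) v∈ ; pathOf≡ , posOf≡ = lookup⇒coordinates j k eq
    in pathOf≡ , subst (_< m) (≡.sym posOf≡) k<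

  ∈-drop-path : ∀ {j v} m → v ∈ drop m (path j) → pathOf v ≡ j × m ≤ posOf v
  ∈-drop-path {j} m v∈ =
    let k , m≤ , eq = ∈-drop⁻ m (path j) v∈ ; pathOf≡ , posOf≡ = lookup⇒coordinates j k eq
    in pathOf≡ , subst (m ≤_) (≡.sym posOf≡) m≤

module Construction {n} (G : Graph n) (A B : List (Fin n)) (R : List (List (Fin n)))
  (R-unique : PerfectUniqueLinkage G A B R) (Q : List (List (Fin n))) (Q-paths : DisjointPaths G Q) where

  R-linkage : Linkage G A B R
  R-linkage = proj₁ (proj₁ R-unique)

  open Coordinates {G = G} (proj₁ R-linkage) (proj₂ R-unique) public

  edges : List (Fin n) → List (Fin n × Fin n)
  edges (x ∷ y ∷ p) = (x , y) ∷ (y , x) ∷ edges (y ∷ p)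
  edges _ = []

  Q-edges : List (Fin n × Fin n)
  Q-edges = concatMap edges Q

  QEdge : Fin n → Fin n → Set
  QEdge u v = (u , v) ∈ Q-edges

  QLink : Fin n → Fin n → Set
  QLink u v = QEdge u v × QEdge v u

  QEdge-adj : ∀ {u v} → QEdge u v → Adj G u v
  QEdge-adj e∈ with q , q∈Q , e∈q ← find (∈ₚ.∈-concatMap⁻ edges {xs = Q} e∈) =
    edge-adj q (proj₂ (proj₂ (All.lookup (proj₁ Q-paths) q∈Q))) e∈q
    where
    edge-adj : ∀ q → Linked (Adj G) q → ∀ {e} → e ∈ edges q → Adj G (proj₁ e) (proj₂ e)
    edge-adj (x ∷ y ∷ p) (a ∷ l) (here refl) = a
    edge-adj (x ∷ y ∷ p) (a ∷ l) (there (here refl)) = Graph.sym G a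
    edge-adj (x ∷ y ∷ p) (a ∷ l) (there (there e∈)) = edge-adj (y ∷ p) l e∈

  Q-linked : ∀ {q} → q ∈ Q → Linked QLink q
  Q-linked {q} q∈Q = linked q λ e∈ → ∈ₚ.∈-concatMap⁺ edges {xs = Q} (Any.map (λ { refl → e∈ }) q∈Q)
    where
    linked : ∀ p → (∀ {e} → e ∈ edges p → e ∈ Q-edges) → Linked QLink p
    linked [] _ = []
    linked (x ∷ []) _ = [-]
    linked (x ∷ y ∷ p) sub = (sub (here refl) , sub (there (here refl))) ∷ linked (y ∷ p) (sub ∘ there ∘ there)

  Cut : Set
  Cut = Fin K → ℕ

  _≤ᶜ_ : Cut → Cut → Set
  c ≤ᶜ c′ = ∀ j → c j ≤ c′ j

  Valid : Cut → Set
  Valid c = ∀ j → c j < len j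

  Unfinished : Cut → Fin K → Set
  Unfinished c j = suc (c j) < len j

  Finished : Cut → Set
  Finished c = ∀ j → ¬ Unfinished c j

  At : Fin K → ℕ → Fin n → Set
  At j p v = pathOf v ≡ j × posOf v ≡ p

  at? : ∀ j p → Decidable (At j p)
  at? j p v = (pathOf v Fin.≟ j) ×-dec (posOf v ≟ p)

  Settled Below OnFront Ahead : Cut → Fin n → Set
  Settled c v = posOf v ≤ c (pathOf v)
  Below   c v = posOf v < c (pathOf v)
  OnFront c v = posOf v ≡ c (pathOf v)
  Ahead   c v = c (pathOf v) < posOf v

  Separated : Cut → Set
  Separated c = ∀ {u v} → QEdge u v → Settled c u → Ahead c v → OnFront c u

  front : (c : Cut) → Valid c → Fin K → Fin n
  front c valid j = lookup (path j) (fromℕ< (valid j))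

  front-at : ∀ {c} (valid : Valid c) j → At j (c j) (front c valid j)
  front-at {c} valid j with pathOf≡ , posOf≡ ← lookup⇒coordinates j (fromℕ< (valid j)) refl =
    pathOf≡ , trans posOf≡ (Finₚ.toℕ-fromℕ< (valid j))

  OnFront⇒front : ∀ {c} (valid : Valid c) {v} → OnFront c v → v ≡ front c valid (pathOf v)
  OnFront⇒front valid {v} onFront with pathOf≡ , posOf≡ ← front-at valid (pathOf v) =
    coordinates-injective (≡.sym pathOf≡) (trans onFront (≡.sym posOf≡))

  -- along a Q-path avoiding the front, Separated forbids stepping between settled and ahead vertices
  module _ {c : Cut} (separated : Separated c) where

    settled-spreads : ∀ q → Linked QLink q → All (¬_ ∘ OnFront c) q →
                      Any (Settled c) q → All (Settled c) q
    settled-spreads (x ∷ xs) linked off settled = forward x xs linked off (backward x xs linked off settled)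
      where
      forward : ∀ x xs → Linked QLink (x ∷ xs) → All (¬_ ∘ OnFront c) (x ∷ xs) →
                Settled c x → All (Settled c) (x ∷ xs)
      forward x [] _ _ sx = sx ∷ []
      forward x (y ∷ ys) ((e , _) ∷ l) (x-off ∷ off) sx with posOf y ≤? c (pathOf y)
      ... | yes sy = sx ∷ forward y ys l off sy
      ... | no ¬sy = ⊥-elim (x-off (separated e sx (≰⇒> ¬sy)))

      backward : ∀ x xs → Linked QLink (x ∷ xs) → All (¬_ ∘ OnFront c) (x ∷ xs) →
                 Any (Settled c) (x ∷ xs) → Settled c x
      backward x xs _ _ (here sx) = sx
      backward x (y ∷ ys) ((_ , e) ∷ l) (_ ∷ off) (there s) with posOf x ≤? c (pathOf x)
      ... | yes sx = sx
      ... | no ¬sx = ⊥-elim (All.head off (separated e (backward y ys l off s) (≰⇒> ¬sx)))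

  At-unique : ∀ {j p v v′} → At j p v → At j p v′ → v ≡ v′
  At-unique (j≡ , p≡) (j≡′ , p≡′) = coordinates-injective (trans j≡ (≡.sym j≡′)) (trans p≡ (≡.sym p≡′))

  -- Rerouting

  BlockingEdge : Cut → Fin K → Fin n × Fin n → Set
  BlockingEdge c j (u , v) = At j (c j) u × Ahead c v × ¬ At j (suc (c j)) v

  blockingEdge? : ∀ c j → Decidable (BlockingEdge c j)
  blockingEdge? c j (u , v) = at? j (c j) u ×-dec (c (pathOf v) <? posOf v) ×-dec ¬? (at? j (suc (c j)) v)

  Blocked : Cut → Fin K → Set
  Blocked c j = Any (BlockingEdge c j) Q-edges

  R-ends : ∀ j → StartsIn A (path j) × EndsIn B (path j)
  R-ends j = All.lookup (proj₂ (proj₂ R-linkage)) (∈ₚ.∈-lookup j)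

  -- If every unfinished path is blocked, following blocking edges yields a cycle of paths along
  -- which R can be rerouted into a second (A,B)-linkage.
  module Reroute {c : Cut} (valid : Valid c) (stuck : ∀ j → Unfinished c j → Blocked c j) where

    target : Fin K → Fin n
    target j with suc (c j) <? len j
    ... | yes u = proj₂ (proj₁ (find (stuck j u)))
    ... | no _  = front c valid j   -- junk: target is only used on unfinished paths

    target-blocks : ∀ {j} → Unfinished c j →
      QEdge (front c valid j) (target j) × Ahead c (target j) × ¬ At j (suc (c j)) (target j)
    target-blocks {j} u with suc (c j) <? len j
    ... | no ¬u = ⊥-elim (¬u u)
    ... | yes u′ with (s , t) , e∈ , s-at , ahead , ¬next ← find (stuck j u′) =
      subst (λ s → QEdge s t) (At-unique s-at (front-at valid j)) e∈ , ahead , ¬next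

    next : Fin K → Fin K
    next j = pathOf (target j)

    next-unfinished : ∀ {j} → Unfinished c j → Unfinished c (next j)
    next-unfinished u = <-≤-trans (s≤s (proj₁ (proj₂ (target-blocks u)))) (posOf<len (target _))

    splice : Fin K → List (Fin n)
    splice j = take (suc (c j)) (path j) ++ drop (posOf (target j)) (path (next j))

    ∈-take⇒settled : ∀ j {v} → v ∈ take (suc (c j)) (path j) → pathOf v ≡ j × Settled c v
    ∈-take⇒settled j v∈ with refl , v< ← ∈-take-path (suc (c j)) v∈ = refl , ≤-pred v<

    ∈-drop⇒ahead : ∀ {j v} → Unfinished c j → v ∈ drop (posOf (target j)) (path (next j)) →
                   pathOf v ≡ next j × Ahead c v
    ∈-drop⇒ahead {j} {v} u v∈ with pathOf≡ , t≤v ← ∈-drop-path (posOf (target j)) v∈ =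
      pathOf≡ , subst (λ i → c i < posOf v) (≡.sym pathOf≡) (<-≤-trans (proj₁ (proj₂ (target-blocks u))) t≤v)

    splice-isPath : ∀ {j} → Unfinished c j → IsPath G (splice j)
    splice-isPath {j} u =
      take-++-drop-isPath {G = G} (c j) (valid j) (indexOf (target j)) (path-isPath j) (path-isPath (next j))
        (subst (Adj G (front c valid j)) (≡.sym (lookup-indexOf (target j))) (QEdge-adj (proj₁ (target-blocks u))))
        (λ (v , v∈take , v∈drop) → <⇒≱ (proj₂ (∈-drop⇒ahead u v∈drop)) (proj₂ (∈-take⇒settled j v∈take)))

    splice-ends : ∀ j → StartsIn A (splice j) × EndsIn B (splice j)
    splice-ends j = StartsIn-take-++ (c j) _ (proj₁ (R-ends j)) ,
                    EndsIn-++-drop (take (suc (c j)) (path j)) (indexOf (target j)) (proj₂ (R-ends (next j)))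

    splice-starts-on : ∀ {j k} → path k ≡ splice j → k ≡ j
    splice-starts-on {j} eq with x , x∈ ← head∈take-suc (c j) (path j) (len>0 j) =
      trans (≡.sym (∈-path⇒pathOf (subst (x ∈_) (≡.sym eq) (∈ₚ.∈-++⁺ˡ x∈)))) (proj₁ (∈-take⇒settled j x∈))

    path≡splice⇒drop : ∀ {j} → path j ≡ splice j →
                       drop (suc (c j)) (path j) ≡ target j ∷ drop (suc (posOf (target j))) (path (next j))
    path≡splice⇒drop {j} eq =
      trans (Listₚ.++-cancelˡ (take (suc (c j)) (path j)) _ _ (trans (Listₚ.take++drop≡id (suc (c j)) (path j)) eq))
            (subst (λ t → drop (posOf (target j)) (path (next j)) ≡ t ∷ drop (suc (posOf (target j))) (path (next j)))
                   (lookup-indexOf (target j))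
                   (drop-lookup (path (next j)) (indexOf (target j))))

    -- the splice leaves path j right after its front, but not towards the next vertex of path j
    splice-≢path : ∀ {j} → Unfinished c j → path j ≢ splice j
    splice-≢path {j} u eq
      with k , k≡ , lookup≡ ← drop≡∷⇒lookup (suc (c j)) (path j) (path≡splice⇒drop eq)
      with pathOf≡ , posOf≡ ← lookup⇒coordinates j k lookup≡
      = proj₂ (proj₂ (target-blocks u)) (pathOf≡ , trans posOf≡ k≡)

    splice-∉R : ∀ {j} → Unfinished c j → ∀ k → path k ≢ splice j
    splice-∉R u k eq with refl ← splice-starts-on eq = splice-≢path u eq

    module _ {j₀ : Fin K} (u₀ : Unfinished c j₀) where
      open CycleIn (Iteration.invariant⇒cycleIn next (Unfinished c) next-unfinished u₀)

      rerouted : ∀ j → Dec (OnCycle j) → List (Fin n)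
      rerouted j (yes _) = splice j
      rerouted j (no _)  = path j

      Owner : ∀ j → Dec (OnCycle j) → Fin n → Set
      Owner j (yes _) v = (pathOf v ≡ j × Settled c v) ⊎ (pathOf v ≡ next j × Ahead c v)
      Owner j (no _)  v = pathOf v ≡ j

      ∈-rerouted⇒owner : ∀ j d {v} → v ∈ rerouted j d → Owner j d v
      ∈-rerouted⇒owner j (yes on) v∈ with ∈ₚ.∈-++⁻ (take (suc (c j)) (path j)) v∈
      ... | inj₁ v∈take = inj₁ (∈-take⇒settled j v∈take)
      ... | inj₂ v∈drop = inj₂ (∈-drop⇒ahead (on⇒P on) v∈drop)
      ∈-rerouted⇒owner j (no _) v∈ = ∈-path⇒pathOf v∈

      owners-distinct : ∀ {j j′} → j ≢ j′ → ∀ d d′ {v} → Owner j d v → Owner j′ d′ v → ⊥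
      owners-distinct j≢j′ (yes on) (yes on′) (inj₁ (j≡ , _)) (inj₁ (j≡′ , _)) = j≢j′ (trans (≡.sym j≡) j≡′)
      owners-distinct j≢j′ (yes on) (yes on′) (inj₁ (_ , s)) (inj₂ (_ , a)) = <⇒≱ a s
      owners-distinct j≢j′ (yes on) (yes on′) (inj₂ (_ , a)) (inj₁ (_ , s)) = <⇒≱ a s
      owners-distinct j≢j′ (yes on) (yes on′) (inj₂ (j≡ , _)) (inj₂ (j≡′ , _)) =
        j≢j′ (F-injective on on′ (trans (≡.sym j≡) j≡′))
      owners-distinct j≢j′ (yes on) (no _) (inj₁ (j≡ , _)) j≡′ = j≢j′ (trans (≡.sym j≡) j≡′)
      owners-distinct j≢j′ (yes on) (no off′) (inj₂ (j≡ , _)) j≡′ = off′ (subst OnCycle (trans (≡.sym j≡) j≡′) (F-on on))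
      owners-distinct j≢j′ (no _) (yes on′) j≡ (inj₁ (j≡′ , _)) = j≢j′ (trans (≡.sym j≡) j≡′)
      owners-distinct j≢j′ (no off) (yes on′) j≡ (inj₂ (j≡′ , _)) = off (subst OnCycle (trans (≡.sym j≡′) j≡) (F-on on′))
      owners-distinct j≢j′ (no _) (no _) j≡ j≡′ = j≢j′ (trans (≡.sym j≡) j≡′)

      rerouting : List (List (Fin n))
      rerouting = tabulate (λ j → rerouted j (onCycle? j))

      rerouting-linkage : Linkage G A B rerouting
      rerouting-linkage =
        ( Allₚ.tabulate⁺ (λ j → isPath j (onCycle? j))
        , AllPairsₚ.tabulate⁺ (λ {j} {j′} j≢j′ (v , v∈ , v∈′) →
            owners-distinct j≢j′ (onCycle? j) (onCycle? j′) (∈-rerouted⇒owner j _ v∈) (∈-rerouted⇒owner j′ _ v∈′)) )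
        , trans (Listₚ.length-tabulate _) (proj₁ (proj₂ R-linkage))
        , Allₚ.tabulate⁺ (λ j → ends j (onCycle? j))
        where
        isPath : ∀ j d → IsPath G (rerouted j d)
        isPath j (yes on) = splice-isPath (on⇒P on)
        isPath j (no _) = path-isPath j
        ends : ∀ j d → StartsIn A (rerouted j d) × EndsIn B (rerouted j d)
        ends j (yes _) = splice-ends j
        ends j (no _) = R-ends j

      contradiction : ⊥
      contradiction with onCycle? root
                       | ∈-resp-↭ (proj₂ (proj₁ R-unique) rerouting rerouting-linkage) (∈ₚ.∈-tabulate⁺ root)
      ... | no off | _ = off root-on
      ... | yes on | r∈R = splice-∉R (on⇒P on) (Any.index r∈R) (≡.sym (Anyₚ.lookup-index r∈R))

  -- Sweeping

  advance : Cut → Fin K → Cut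
  advance c j i with i Fin.≟ j
  ... | yes _ = suc (c j)
  ... | no _  = c i

  advance-self : ∀ c j → advance c j j ≡ suc (c j)
  advance-self c j with j Fin.≟ j
  ... | yes _  = refl
  ... | no j≢j = ⊥-elim (j≢j refl)

  advance-at : ∀ c {i j} → i ≡ j → advance c j i ≡ suc (c j)
  advance-at c refl = advance-self c _

  advance-other : ∀ c {i j} → i ≢ j → advance c j i ≡ c i
  advance-other c {i} {j} i≢j with i Fin.≟ j
  ... | yes i≡j = ⊥-elim (i≢j i≡j)
  ... | no _    = refl

  ≤ᶜ-advance : ∀ c j → c ≤ᶜ advance c j
  ≤ᶜ-advance c j i with i Fin.≟ j
  ... | yes refl = n≤1+n (c i)
  ... | no _     = ≤-refl

  advance-valid : ∀ {c j} → Valid c → Unfinished c j → Valid (advance c j)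
  advance-valid {c} {j} valid u i with i Fin.≟ j
  ... | yes refl = u
  ... | no _     = valid i

  advance-separated : ∀ {c j} → Separated c → ¬ Blocked c j → Separated (advance c j)
  advance-separated {c} {j} separated unblocked {u} {v} e settled ahead = by-path (pathOf u Fin.≟ j)
    where
    ahead-c : Ahead c v
    ahead-c = ≤-<-trans (≤ᶜ-advance c j (pathOf v)) ahead

    by-path : Dec (pathOf u ≡ j) → OnFront (advance c j) u
    by-path (no u∉j) = subst (posOf u ≡_) (≡.sym (advance-other c u∉j))
                         (separated e (subst (posOf u ≤_) (advance-other c u∉j) settled) ahead-c)
    by-path (yes u∈j) with posOf u ≟ suc (c j)
    ... | yes u-new = trans u-new (≡.sym (advance-at c u∈j))
    ... | no ¬u-new = ⊥-elim (unblocked (lose e ((u∈j , trans (separated e settled-c ahead-c) (cong c u∈j)) , ahead-c , ¬next)))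
      where
      settled-c : Settled c u
      settled-c = subst (λ i → posOf u ≤ c i) (≡.sym u∈j)
        (≤-pred (≤∧≢⇒< (subst (posOf u ≤_) (advance-at c u∈j) settled) ¬u-new))
      ¬next : ¬ At j (suc (c j)) v
      ¬next (v∈j , v-new) = <-irrefl (≡.sym v-new) (subst (_< posOf v) (advance-at c v∈j) ahead)

  below? : ∀ c → Decidable (All (Below c))
  below? c = All.all? (λ v → posOf v <? c (pathOf v))

  #below : Cut → ℕ
  #below c = count (below? c) Q

  fronts : (c : Cut) → Valid c → List (Fin n)
  fronts c valid = tabulate (front c valid)

  OnFront⇒∈fronts : ∀ {c} (valid : Valid c) {v} → OnFront c v → v ∈ fronts c valid
  OnFront⇒∈fronts valid {v} onFront =
    subst (_∈ fronts _ valid) (≡.sym (OnFront⇒front valid onFront)) (∈ₚ.∈-tabulate⁺ (pathOf v))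

  count-meets-fronts : ∀ {c} (valid : Valid c) → count (meets? (fronts c valid)) Q ≤ K
  count-meets-fronts valid =
    ≤-trans (count-meets-≤ (fronts _ valid) (proj₂ Q-paths)) (≤-reflexive (Listₚ.length-tabulate _))

  below-advance : ∀ c j {q} → All (Below (advance c j)) q → All (Below c) q ⊎ Any (At j (c j)) q
  below-advance c j [] = inj₁ []
  below-advance c j {v ∷ q} (b ∷ bs) with below-advance c j bs | posOf v <? c (pathOf v)
  ... | inj₂ at   | _       = inj₂ (there at)
  ... | inj₁ bs′  | yes b′  = inj₁ (b′ ∷ bs′)
  ... | inj₁ _    | no ¬b′  = inj₂ (here (by-path (pathOf v Fin.≟ j)))
    where
    by-path : Dec (pathOf v ≡ j) → At j (c j) v
    by-path (no v∉j) = ⊥-elim (¬b′ (subst (posOf v <_) (advance-other c v∉j) b))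
    by-path (yes v∈j) = v∈j , ≤-antisym (≤-pred (subst (posOf v <_) (advance-at c v∈j) b))
                                        (subst (λ i → c i ≤ posOf v) v∈j (≮⇒≥ ¬b′))

  #below-advance : ∀ {c} → Valid c → ∀ j → #below (advance c j) ≤ #below c + 1
  #below-advance {c} valid j =
    ≤-trans (count-≤-+ (below? (advance c j)) (below? c) (Any.any? (front c valid j Fin.≟_)) Q
               (All.tabulate λ _ b → Sum.map₂ (Any.map (At-unique (front-at valid j))) (below-advance c j b)))
            (+-monoʳ-≤ (#below c) (count-∋-≤1 (front c valid j) (proj₂ Q-paths)))

  remaining : Cut → ℕ
  remaining c = ∑ (λ j → len j ∸ c j)

  remaining-advance : ∀ {c j} → Unfinished c j → remaining (advance c j) < remaining c
  remaining-advance {c} {j} u = ∑-mono-< (λ i → ∸-monoʳ-≤ (len i) (≤ᶜ-advance c j i)) j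
    (subst (λ a → len j ∸ a < len j ∸ c j) (≡.sym (advance-self c j)) (∸-monoʳ-< (n<1+n (c j)) (<⇒≤ u)))

  record GoodCut : Set where
    constructor goodCut
    field
      cut       : Cut
      valid     : Valid cut
      separated : Separated cut
  open GoodCut

  -- Some unfinished path is unblocked, since otherwise Reroute contradicts the uniqueness of R.
  advance-good : (s : GoodCut) → ∀ {j₀} → Unfinished (cut s) j₀ →
    Σ GoodCut λ s′ → cut s ≤ᶜ cut s′ × #below (cut s′) ≤ #below (cut s) + 1 × remaining (cut s′) < remaining (cut s)
  advance-good (goodCut c valid separated) u₀
    with Finₚ.any? (λ j → (suc (c j) <? len j) ×-dec ¬? (Any.any? (blockingEdge? c j) Q-edges))
  ... | yes (j , u , unblocked) =
    goodCut (advance c j) (advance-valid valid u) (advance-separated separated unblocked) ,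
    ≤ᶜ-advance c j , #below-advance valid j , remaining-advance u
  ... | no none = ⊥-elim (Reroute.contradiction valid stuck u₀)
    where
    stuck : ∀ j → Unfinished c j → Blocked c j
    stuck j u = decidable-stable (Any.any? (blockingEdge? c j) Q-edges) (λ unblocked → none (j , u , unblocked))

  Reached : ℕ → GoodCut → Set
  Reached t s = #below (cut s) ≤ t × (#below (cut s) ≡ t ⊎ Finished (cut s))

  sweep : (s : GoodCut) (t : ℕ) → #below (cut s) ≤ t → Σ GoodCut λ s′ → cut s ≤ᶜ cut s′ × Reached t s′
  sweep s = go (suc (remaining (cut s))) s ≤-refl
    where
    go : ∀ fuel (s : GoodCut) → remaining (cut s) < fuel → ∀ t → #below (cut s) ≤ t →
         Σ GoodCut λ s′ → cut s ≤ᶜ cut s′ × Reached t s′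
    go (suc fuel) s r< t b≤ with #below (cut s) ≟ t | Finₚ.any? (λ j → suc (cut s j) <? len j)
    ... | yes b≡ | _            = s , (λ _ → ≤-refl) , b≤ , inj₁ b≡
    ... | no _   | no none      = s , (λ _ → ≤-refl) , b≤ , inj₂ (λ j u → none (j , u))
    ... | no b≢  | yes (_ , u)
      with s₁ , s≤s₁ , b₁≤ , r₁< ← advance-good s u
      with s₂ , s₁≤s₂ , reached ← go fuel s₁ (<-≤-trans r₁< (≤-pred r<)) t (≤-trans b₁≤ (subst (_≤ t) (+-comm 1 _) (≤∧≢⇒< b≤ b≢)))
      = s₂ , (λ j → ≤-trans (s≤s₁ j) (s₁≤s₂ j)) , reached

  finished⇒settled : ∀ {c} → Finished c → ∀ v → Settled c v
  finished⇒settled finished v = ≤-pred (<-≤-trans (posOf<len v) (≮⇒≥ (finished (pathOf v))))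

  finished-count : ∀ {c} (valid : Valid c) → Finished c → length Q ≤ #below c + K
  finished-count {c} valid finished =
    ≤-trans (length-≤-count-+ (below? c) (meets? (fronts c valid)) Q (All.tabulate λ {q} _ → below-or-meets q))
            (+-monoʳ-≤ (#below c) (count-meets-fronts valid))
    where
    below-or-meets : ∀ q → All (Below c) q ⊎ Meets (fronts c valid) q
    below-or-meets [] = inj₁ []
    below-or-meets (v ∷ q) with posOf v <? c (pathOf v) | below-or-meets q
    ... | no ¬b | _       = inj₂ (here (OnFront⇒∈fronts valid (≤-antisym (finished⇒settled finished v) (≮⇒≥ ¬b))))
    ... | yes b | inj₁ bs = inj₁ (b ∷ bs)
    ... | yes _ | inj₂ m  = inj₂ (there m)

  Between : Cut → Cut → Fin n → Set
  Between lo hi v = Ahead lo v × Below hi v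

  between? : ∀ lo hi → Decidable (All (Between lo hi))
  between? lo hi = All.all? (λ v → (lo (pathOf v) <? posOf v) ×-dec (posOf v <? hi (pathOf v)))

  -- a Q-path below hi that avoids the front of lo and is not entirely ahead of it has a settled
  -- vertex, hence lies below lo by settled-spreads
  band-count : ∀ {lo} (valid : Valid lo) → Separated lo → ∀ hi →
               #below hi ≤ count (between? lo hi) Q + (#below lo + K)
  band-count {lo} valid separated hi =
    ≤-trans (count-≤-+ (below? hi) (between? lo hi) (λ q → below? lo q ⊎-dec meets? (fronts lo valid) q) Q
                       (All.tabulate classify))
            (+-monoʳ-≤ _ (≤-trans (count-≤-+ _ (below? lo) (meets? (fronts lo valid)) Q (All.tabulate λ _ → id))
                                  (+-monoʳ-≤ (#below lo) (count-meets-fronts valid))))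
    where
    classify : ∀ {q} → q ∈ Q → All (Below hi) q →
               All (Between lo hi) q ⊎ (All (Below lo) q ⊎ Meets (fronts lo valid) q)
    classify {q} q∈Q below-hi with meets? (fronts lo valid) q
    ... | yes m = inj₂ (inj₂ m)
    ... | no ¬m with All.all? (λ v → lo (pathOf v) <? posOf v) q
    ...   | yes ahead = inj₁ (All.zip (ahead , below-hi))
    ...   | no ¬ahead = inj₂ (inj₁ (All.zipWith (λ (s , off) → ≤∧≢⇒< s off) (settled , off-front)))
      where
      off-front : All (¬_ ∘ OnFront lo) q
      off-front = Allₚ.¬Any⇒All¬ q (¬m ∘ Any.map (OnFront⇒∈fronts valid))
      settled : All (Settled lo) q
      settled = settled-spreads {lo} separated q (Q-linked q∈Q) off-front
                  (Any.map ≮⇒≥ (Allₚ.¬All⇒Any¬ (λ v → lo (pathOf v) <? posOf v) q ¬ahead))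

  start : GoodCut
  start = goodCut (λ _ → 0) len>0 (λ _ settled _ → n≤0⇒n≡0 settled)

  #below-start : #below (cut start) ≡ 0
  #below-start = cong length (Listₚ.filter-none (below? (cut start))
                   (All.tabulate λ q∈Q → nothing-below (proj₁ (All.lookup (proj₁ Q-paths) q∈Q))))
    where
    nothing-below : ∀ {q} → q ≢ [] → ¬ All (Below (cut start)) q
    nothing-below {[]} q≢[] _ = q≢[] refl
    nothing-below {_ ∷ _} _ (() ∷ _)

  len∸1 : ∀ j → suc (len j ∸ 1) ≡ len j
  len∸1 j = trans (+-comm 1 _) (m∸n+n≡m (len>0 j))

  <len⇒≤len∸1 : ∀ {j p} → p < len j → p ≤ len j ∸ 1
  <len⇒≤len∸1 {j} p< = ≤-pred (subst (_ <_) (≡.sym (len∸1 j)) p<)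

  end : GoodCut
  end = goodCut (λ j → len j ∸ 1) end-valid
                (λ {_} {v} _ _ ahead → ⊥-elim (<⇒≱ ahead (<len⇒≤len∸1 (posOf<len v))))
    where
    end-valid : Valid (λ j → len j ∸ 1)
    end-valid j = subst (len j ∸ 1 <_) (len∸1 j) (n<1+n _)

  end-finished : Finished (cut end)
  end-finished j u = <-irrefl (len∸1 j) u

  reached-exactly : ∀ {t s} → t + K ≤ length Q → Reached t s → #below (cut s) ≡ t
  reached-exactly room (_ , inj₁ b≡) = b≡
  reached-exactly {t} {s} room (b≤ , inj₂ finished) =
    ≤-antisym b≤ (+-cancelʳ-≤ K t _ (≤-trans room (finished-count (valid s) finished)))

  -- The slicing

  module Levels (M w : ℕ) (M>0 : 0 < M) (enough : M * (K + w) + K ≤ length Q) where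

    W : ℕ
    W = K + w

    extend : ∀ {m} → Σ GoodCut (Reached (m * W)) → Σ GoodCut (Reached (suc m * W))
    extend {m} (s , b≤ , _) = map₂ proj₂ (sweep s (suc m * W) (≤-trans b≤ (m≤n+m (m * W) W)))

    extend-≤ᶜ : ∀ {m} (x : Σ GoodCut (Reached (m * W))) → cut (proj₁ x) ≤ᶜ cut (proj₁ (extend {m} x))
    extend-≤ᶜ {m} (s , b≤ , _) = proj₁ (proj₂ (sweep s (suc m * W) (≤-trans b≤ (m≤n+m (m * W) W))))

    chain : ∀ m → Σ GoodCut (Reached (m * W))
    chain zero = start , ≤-reflexive #below-start , inj₁ #below-start
    chain (suc m) = extend {m} (chain m)

    chain-≤ᶜ : ∀ d m → cut (proj₁ (chain m)) ≤ᶜ cut (proj₁ (chain (d + m)))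
    chain-≤ᶜ zero m j = ≤-refl
    chain-≤ᶜ (suc d) m j = ≤-trans (chain-≤ᶜ d m j) (extend-≤ᶜ {d + m} (chain (d + m)) j)

    -- the cuts v_0, …, v_M of the slicing; the last one must be the end of every path
    level : ℕ → GoodCut
    level m with m <? M
    ... | yes _ = proj₁ (chain m)
    ... | no _  = end

    level-≤ᶜ : ∀ {m m′} → m ≤ m′ → cut (level m) ≤ᶜ cut (level m′)
    level-≤ᶜ {m} {m′} m≤m′ with m <? M | m′ <? M
    ... | yes _   | yes _    = subst (λ k → cut (proj₁ (chain m)) ≤ᶜ cut (proj₁ (chain k))) (m∸n+n≡m m≤m′) (chain-≤ᶜ (m′ ∸ m) m)
    ... | yes _   | no _     = λ j → <len⇒≤len∸1 (valid (proj₁ (chain m)) j)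
    ... | no m≮M  | yes m′<M = ⊥-elim (m≮M (≤-<-trans m≤m′ m′<M))
    ... | no _    | no _     = λ _ → ≤-refl

    level-0 : ∀ j → cut (level 0) j ≡ 0
    level-0 j with 0 <? M
    ... | yes _ = refl
    ... | no 0≮M = ⊥-elim (0≮M M>0)

    level-M : ∀ j → cut (level M) j ≡ len j ∸ 1
    level-M j with M <? M
    ... | yes M<M = ⊥-elim (<-irrefl refl M<M)
    ... | no _    = refl

    level-below-≤ : ∀ {m} → m < M → #below (cut (level m)) ≤ m * W
    level-below-≤ {m} m<M with m <? M
    ... | yes _   = proj₁ (proj₂ (chain m))
    ... | no m≮M  = ⊥-elim (m≮M m<M)

    level-below-≥ : ∀ {m} → m ≤ M → m * W ≤ #below (cut (level m))
    level-below-≥ {m} m≤M with m <? M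
    ... | yes _ = ≤-reflexive (≡.sym (reached-exactly {m * W} {proj₁ (chain m)} (≤-trans (+-monoˡ-≤ K (*-monoˡ-≤ W m≤M)) enough) (proj₂ (chain m))))
    ... | no _  = +-cancelʳ-≤ K _ _ (≤-trans (+-monoˡ-≤ K (*-monoˡ-≤ W m≤M))
                                   (≤-trans enough (finished-count (valid end) end-finished)))

    band-width : ∀ {m} → m < M → w ≤ count (between? (cut (level m)) (cut (level (suc m)))) Q
    band-width {m} m<M = +-cancelʳ-≤ (m * W + K) w _
      (begin
        w + (m * W + K)                    ≡⟨ reassociate K w m ⟩
        suc m * W                          ≤⟨ level-below-≥ m<M ⟩
        #below hi                          ≤⟨ band-count (valid (level m)) (separated (level m)) hi ⟩
        count (between? lo hi) Q + (#below lo + K)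
                                           ≤⟨ +-monoʳ-≤ (count (between? lo hi) Q) (+-monoˡ-≤ K (level-below-≤ m<M)) ⟩
        count (between? lo hi) Q + (m * W + K) ∎)
      where
      open ≤-Reasoning
      lo hi : Cut
      lo = cut (level m)
      hi = cut (level (suc m))
      reassociate : ∀ K w m → w + (m * (K + w) + K) ≡ suc m * (K + w)
      reassociate = solve-∀

    slicing : Slicing M R
    slicing j = record
      { pos   = position
      ; mono  = λ i i′ i≤i′ → subst₂ _≤_ (≡.sym (toℕ-position i)) (≡.sym (toℕ-position i′)) (level-≤ᶜ i≤i′ j)
      ; first = trans (toℕ-position Fin.zero) (level-0 j)
      ; last  = trans (toℕ-position (Fin.fromℕ M)) (subst (λ m → cut (level m) j ≡ len j ∸ 1)
                                                          (≡.sym (Finₚ.toℕ-fromℕ M)) (level-M j))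
      }
      where
      position : Fin (suc M) → Fin (len j)
      position i = fromℕ< (valid (level (toℕ i)) j)
      toℕ-position : ∀ i → toℕ (position i) ≡ cut (level (toℕ i)) j
      toℕ-position i = Finₚ.toℕ-fromℕ< (valid (level (toℕ i)) j)

    between⇒InQi : ∀ i {q} → All (Between (cut (level (toℕ i))) (cut (level (suc (toℕ i))))) q → InQi R slicing i q
    between⇒InQi i between v v∈q _ =
      pathOf v , indexOf v , lookup-indexOf v ,
      subst (_< posOf v) (≡.sym (trans (Finₚ.toℕ-fromℕ< _) (cong (λ m → cut (level m) (pathOf v)) (Finₚ.toℕ-inject₁ i))))
            (proj₁ (All.lookup between v∈q)) ,
      subst (posOf v <_) (≡.sym (Finₚ.toℕ-fromℕ< _)) (proj₂ (All.lookup between v∈q))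

    width : WidthAtLeast R slicing Q w
    width i = filter (between? lo hi) Q , filter-⊆ (between? lo hi) Q , band-width (Finₚ.toℕ<n i) ,
              All.map (between⇒InQi i) (Allₚ.all-filter (between? lo hi) Q)
      where
      lo hi : Cut
      lo = cut (level (toℕ i))
      hi = cut (level (suc (toℕ i)))

  K≡|A| : K ≡ length A
  K≡|A| = proj₁ (proj₂ R-linkage)

theorem4p8 : ∀ {n} (G : Graph n) (A B : List (Fin n)) (N : ℕ) →
    Unique A → Unique B → length A ≡ N → length B ≡ N → 0 < N →
    (R : List (List (Fin n))) → PerfectUniqueLinkage G A B R →
    (Q : List (List (Fin n))) → DisjointPaths G Q →
    All (λ q → Any (Intersect q) R) Q →
    (M w : ℕ) → 0 < M → 0 < w →
    M * w + suc M * N ≤ length Q →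
    Σ (Slicing M R) (λ S → WidthAtLeast R S Q w)
-- The Q-paths meet R because R is perfect.
theorem4p8 G A B N _ _ |A|≡N _ _ R R-unique Q Q-paths _ M w M>0 _ bound = slicing , width
  where
  open Construction G A B R R-unique Q Q-paths
  rearrange : ∀ M w K → M * w + suc M * K ≡ M * (K + w) + K
  rearrange = solve-∀
  enough : M * (K + w) + K ≤ length Q
  enough = subst (_≤ length Q) (rearrange M w K)
                 (subst (λ k → M * w + suc M * k ≤ length Q) (≡.sym (trans K≡|A| |A|≡N)) bound)
  open Levels M w M>0 enough
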